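{- Let $\mathcal G=(V,E)$ be a graph in which loops are allowed, which is e-empty and quasi-projective (within the class of graphs with loops allowed). If some vertex of $\mathcal G$ has a loop, then every vertex of $\mathcal G$ has a loop.
   Context: Graphs are undirected: $E$ is a set of unordered pairs of (not necessarily distinct) vertices; a loop is an edge joining a vertex to itself, and loops are allowed in all graphs considered (including the targets $\mathcal T$ below). A graph is e-empty if there are no edges between distinct vertices (loops may be present). A homomorphism is a map of vertices sending edges to edges; an epimorphism is a surjective homomorphism. A graph $\mathcal S$ is quasi-projective if for every such graph $\mathcal T$, every homomorphism $f:\mathcal S\to\mathcal T$ and every epimorphism $j:\mathcal S\to\mathcal T$, there is an endomorphism $\phi$ of $\mathcal S$ with $j\circ\phi=f$. -}

module Defs where

open import Level using (Level; _⊔_; suc)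
open import Relation.Binary.PropositionalEquality using (_≡_)
open import Relation.Nullary using (¬_)
open import Data.Product using (Σ; ∃; _,_)

-- A graph with loops allowed: a vertex type and a symmetric edge relation
-- (edges are unordered pairs {x , y}; E x x is a loop at x).
record Graph (a b : Level) : Set (suc (a ⊔ b)) where
  field
    V    : Set a
    E    : V → V → Set b
    symE : ∀ {x y} → E x y → E y x
open Graph public

IsHom : ∀ {a b c d} (S : Graph a b) (T : Graph c d) → (V S → V T) → Set (a ⊔ b ⊔ d)
IsHom S T f = ∀ {x y} → E S x y → E T (f x) (f y)

Surjective : ∀ {a c} {A : Set a} {B : Set c} → (A → B) → Set (a ⊔ c)
Surjective {A = A} f = ∀ y → ∃ λ x → f x ≡ y

IsEpi : ∀ {a b c d} (S : Graph a b) (T : Graph c d) → (V S → V T) → Set (a ⊔ b ⊔ c ⊔ d)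
IsEpi S T j = Σ (IsHom S T j) (λ _ → Surjective j)

EEmpty : ∀ {a b} → Graph a b → Set (a ⊔ b)
EEmpty G = ∀ {x y} → E G x y → x ≡ y

HasLoop : ∀ {a b} (G : Graph a b) → V G → Set b
HasLoop G x = E G x x

-- Quasi-projective (targets T range over graphs at the same universe levels):
-- for every homomorphism f : S → T and epimorphism j : S → T there is an
-- endomorphism φ of S with j ∘ φ = f (pointwise).
QuasiProjective : ∀ {a b} → Graph a b → Set (suc (a ⊔ b))
QuasiProjective {a} {b} S =
  (T : Graph a b) (f j : V S → V T) → IsHom S T f → IsEpi S T j →
  Σ (V S → V S) (λ φ → Σ (IsHom S S φ) (λ _ → ∀ x → j (φ x) ≡ f x))

module Submission where

open import Level using (Level)
open import Data.Product using (∃; _,_)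
open import Function using (id; const)
open import Relation.Binary.PropositionalEquality using (refl; subst₂)

open import Defs

-- Map S onto the complete graph on its own vertices by the identity, and
-- also constantly to w. Quasi-projectivity lifts the constant map to an
-- endomorphism φ of S with φ ≡ const w, and φ sends any edge of S to a loop at w.

complete : ∀ {a b} → Set a → Set b → Graph a b
complete A B = record { V = A ; E = λ _ _ → B ; symE = id }

module _ {a b d : Level} (S : Graph a b) {B : Set d} (edge : B) where

  const-isHom : ∀ {c} {A : Set c} (w : A) → IsHom S (complete A B) (const w)
  const-isHom _ _ = edge

  id-isEpi : IsEpi S (complete (V S) B) id
  id-isEpi = (λ _ → edge) , λ y → y , refl

quasiProjective-edge⇒loops : ∀ {a b} (S : Graph a b) → QuasiProjective S →
  ∀ {x y} → E S x y → ∀ w → HasLoop S w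
quasiProjective-edge⇒loops S qp {x} {y} xy w
  with qp (complete (V S) (E S x y)) (const w) id (const-isHom S xy w) (id-isEpi S xy)
... | φ , φ-hom , φ≡w = subst₂ (E S) (φ≡w x) (φ≡w y) (φ-hom xy)

lemma4p5 : ∀ {a b} (G : Graph a b) → EEmpty G → QuasiProjective G →
    (∃ λ v → HasLoop G v) → ∀ w → HasLoop G w
lemma4p5 G _ qp (_ , loop) = quasiProjective-edge⇒loops G qp loop
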